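{- For every integer $i\ge0$ and every integer $j\ge4$, $A(i+1,j)\ge A(i,2j)$.
   Context: $A(0,n)=2n$ for $n\ge0$; for $k\ge1$, $A(k,0)=1$ and $A(k,n)=A(k-1,A(k,n-1))$ for $n\ge1$. -}

module Defs where

open import Data.Nat using (ℕ; zero; suc; _*_)

A : ℕ → ℕ → ℕ
A zero    n       = 2 * n
A (suc k) zero    = 1
A (suc k) (suc n) = A k (A (suc k) n)

{-# OPTIONS --safe #-}
module Submission where

open import Defs
open import Data.Nat using (ℕ; zero; suc; _+_; _*_; _≤_; _<_; _≥_; _≤′_; s≤s; z<s; ≤′-refl; ≤′-step)
open import Data.Nat.Properties using (≤-refl; ≤-trans; <⇒≤; ≤⇒≤′; n≤1+n; m≤m+n; m<m+n; *-monoʳ-≤)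

-- Write A(i+1, j) = A(i, A(i+1, j-1)). Every row A(k+1, ·) dominates
-- A(1, m) = 2^m, so A(i+1, j-1) ≥ 2j once j-1 ≥ 3; monotonicity of A(i, ·) finishes.

mutual
  0<n⇒n<A : ∀ k {n} → 0 < n → n < A k n
  0<n⇒n<A zero    {suc n} _ = s≤s (m<m+n n z<s)
  0<n⇒n<A (suc k) _         = n<A[1+k,n] k _

  n<A[1+k,n] : ∀ k n → n < A (suc k) n
  n<A[1+k,n] k zero    = z<s
  n<A[1+k,n] k (suc n) =
    ≤-trans (s≤s (n<A[1+k,n] k n)) (0<n⇒n<A k (≤-trans z<s (n<A[1+k,n] k n)))

n≤A : ∀ k n → n ≤ A k n
n≤A zero    n = m≤m+n n _
n≤A (suc k) n = <⇒≤ (n<A[1+k,n] k n)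

A-step : ∀ k n → A k n ≤ A k (suc n)
A-step zero    n = *-monoʳ-≤ 2 (n≤1+n n)
A-step (suc k) n = n≤A k (A (suc k) n)

A-mono-≤′ : ∀ k {m n} → m ≤′ n → A k m ≤ A k n
A-mono-≤′ k ≤′-refl       = ≤-refl
A-mono-≤′ k (≤′-step m≤n) = ≤-trans (A-mono-≤′ k m≤n) (A-step k _)

A-mono-≤ : ∀ k {m n} → m ≤ n → A k m ≤ A k n
A-mono-≤ k m≤n = A-mono-≤′ k (≤⇒≤′ m≤n)

A[k,1+n]≤A[1+k,1+n] : ∀ k n → A k (suc n) ≤ A (suc k) (suc n)
A[k,1+n]≤A[1+k,1+n] k n = A-mono-≤ k (n<A[1+k,n] k n)

2*[4+n]≤A[1,3+n] : ∀ n → 2 * (4 + n) ≤ A 1 (3 + n)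
2*[4+n]≤A[1,3+n] zero    = ≤-refl
2*[4+n]≤A[1,3+n] (suc n) =
  *-monoʳ-≤ 2 (≤-trans (m<m+n (4 + n) z<s) (2*[4+n]≤A[1,3+n] n))

2*[4+n]≤A[1+k,3+n] : ∀ k n → 2 * (4 + n) ≤ A (suc k) (3 + n)
2*[4+n]≤A[1+k,3+n] zero    n = 2*[4+n]≤A[1,3+n] n
2*[4+n]≤A[1+k,3+n] (suc k) n =
  ≤-trans (2*[4+n]≤A[1+k,3+n] k n) (A[k,1+n]≤A[1+k,1+n] (suc k) (2 + n))

claim1 : (i j : ℕ) → 4 ≤ j → A (suc i) j ≥ A i (2 * j)
claim1 i _ (s≤s (s≤s (s≤s (s≤s {n = n} _)))) = A-mono-≤ i (2*[4+n]≤A[1+k,3+n] i n)
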